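{- For odd $n\geq 3$, let $\mathrm{Dic}_n=\langle a,x \mid a^{2n}=e,\ x^2=a^n,\ x^{ -1}ax=a^{ -1}\rangle$ be the dicyclic group of order $4n$. Then Player 1 has a winning strategy for $\texttt{REL}(\mathrm{Dic}_n,\{a,x\})$.
   Context: Game $\texttt{REL}(G,S)$: $G$ is a finite group and $S$ a generating set with $e\notin S$. Two players alternate turns, Player 1 first, starting from the empty word $w_0$. On turn $n$ the current player chooses $s_n\in S\cup S^{ -1}$, subject to $s_n\neq s_{n-1}^{ -1}$ when $n>1$, and forms $w_n=w_{n-1}s_n$. If $w_n$ represents the same element of $G$ as some $w_k$ with $0\le k<n$, the player who formed $w_n$ wins. If a player has no legal move, that player loses. -}

module Defs where

open import Data.Nat using (ℕ; zero; suc; _+_; _*_; _∸_; NonZero)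
open import Data.Nat.DivMod using (_%_; m%n<n)
open import Data.Nat.Properties using (m*n≢0)
open import Data.Fin using (Fin; toℕ; fromℕ<)
open import Data.Bool using (Bool; true; false)
open import Data.Product using (_×_; _,_)
open import Data.Sum using (_⊎_)
open import Data.List using (List; []; _∷_)
open import Data.List.Relation.Unary.Any using (Any)
open import Data.List.Membership.Propositional using (_∈_)
open import Data.Maybe using (Maybe; just; nothing)
open import Relation.Binary.PropositionalEquality using (_≡_; _≢_)
open import Relation.Nullary using (¬_)

module REL {G : Set} (_∙_ : G → G → G) (_⁻¹ : G → G) (e : G) (S : List G) where

  Move : G → Set
  Move g = Any (λ s → g ≡ s) S ⊎ Any (λ s → g ≡ s ⁻¹) S

  Legal : Maybe G → G → Set
  Legal nothing  g = Move g
  Legal (just l) g = Move g × (g ≢ l ⁻¹)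

  -- A position: current element w = w_{n-1}, list `past` of the elements
  -- w_0 … w_{n-2} (in reverse order), and the last chosen generator.
  -- Win w past last  : the player about to move has a winning strategy.
  -- Lose w past last : the player about to move loses against every play of
  --                    the opponent (the opponent has a winning strategy);
  --                    in particular this holds when there is no legal move.
  data Win  (w : G) (past : List G) (last : Maybe G) : Set
  data Lose (w : G) (past : List G) (last : Maybe G) : Set

  data Win w past last where
    win-now  : ∀ g → Legal last g → (w ∙ g) ∈ (w ∷ past) → Win w past last
    win-move : ∀ g → Legal last g → ¬ ((w ∙ g) ∈ (w ∷ past)) →
               Lose (w ∙ g) (w ∷ past) (just g) → Win w past last

  data Lose w past last where
    lose : (∀ g → Legal last g →
              ¬ ((w ∙ g) ∈ (w ∷ past)) × Win (w ∙ g) (w ∷ past) (just g)) →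
           Lose w past last

  Player1Wins : Set
  Player1Wins = Win e [] nothing

-- The dicyclic group Dic_n = ⟨ a, x ∣ a^{2n} = e, x² = aⁿ, x⁻¹ a x = a⁻¹ ⟩,
-- realised by its normal forms a^i x^b with i ∈ ℤ/2n, b ∈ {0,1}
-- (the pair (i , b) stands for a^i x^b).

module Dicyclic (n : ℕ) .{{_ : NonZero n}} where

  instance
    nz2n : NonZero (2 * n)
    nz2n = m*n≢0 2 n

  md : ℕ → Fin (2 * n)
  md k = fromℕ< (m%n<n k (2 * n))

  Dic : Set
  Dic = Fin (2 * n) × Bool

  sub : Fin (2 * n) → Fin (2 * n) → ℕ
  sub i j = toℕ i + (2 * n ∸ toℕ j)

  -- multiplication, using x a^j = a^{-j} x and x² = aⁿ
  _∙_ : Dic → Dic → Dic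
  (i , false) ∙ (j , q)     = md (toℕ i + toℕ j) , q
  (i , true)  ∙ (j , false) = md (sub i j) , true
  (i , true)  ∙ (j , true)  = md (sub i j + n) , false

  -- inverses: (a^i)⁻¹ = a^{-i}, (a^i x)⁻¹ = a^{i+n} x
  _⁻¹ : Dic → Dic
  (i , false) ⁻¹ = md (2 * n ∸ toℕ i) , false
  (i , true)  ⁻¹ = md (toℕ i + n) , true

  e : Dic
  e = md 0 , false

  a : Dic
  a = md 1 , false

  x : Dic
  x = md 0 , true

  S : List Dic
  S = a ∷ x ∷ []

  open REL _∙_ _⁻¹ e S public

-- Every element of Dic_n is uniquely a^c x^j with 0 ≤ c < n and j ∈ ℤ/4 (as x² = aⁿ).
-- Right multiplication by a^±1 moves c by ±1 along the lane j (in a direction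
-- fixed by the parity of j), x^±1 turns to the lane j ± 1 keeping c, and a lane
-- leaving column n − 1 upwards re-enters at column 0 in lane j + 2.  Player 1
-- opens with a and keeps advancing.  If the opponent turns, either the cell
-- just below is already visited and Player 1 closes a cycle by stepping down,
-- or Player 1 advances in the new lane.  The parity of the lane stays equal to
-- the parity of the distance to the last columns, so for odd n Player 1 reaches
-- the last three columns in one of three positions; from each of them a short
-- game tree, found by evaluating a bounded search on an abstract window of
-- those columns, wins for Player 1.

module Submission where

open import Defs
open import Data.Bool using (Bool; true; false; not; T; _∧_; _∨_)
open import Data.Bool.Properties using (not-involutive; not-injective; not-¬; ¬-not) renaming (_≟_ to _≟ᵇ_)
open import Data.Empty using (⊥-elim)
import Data.Fin as Fin
open import Data.Fin using (toℕ)
open import Data.Fin.Properties using (toℕ-fromℕ<; toℕ-injective)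
open import Data.List using (List; []; _∷_)
open import Data.Bool.ListAction using (any; all)
open import Data.List.Membership.Propositional using (_∈_; _∉_)
open import Data.List.Relation.Unary.All as All using (All; []; _∷_)
open import Data.List.Relation.Unary.All.Properties using (all⁺)
open import Data.List.Relation.Unary.Any using (here; there; satisfied; toSum)
open import Data.List.Relation.Unary.Any.Properties using (any⁻)
open import Data.Maybe using (Maybe; just; nothing)
open import Data.Nat using (ℕ; zero; suc; _+_; _*_; _∸_; _≤_; _<_; z≤n; s≤s; z<s; NonZero; _<?_; >-nonZero⁻¹)
open import Data.Nat.DivMod using (_%_; m<n⇒m%n≡m; [m+n]%n≡m%n; m%n%n≡m%n; %-distribˡ-+)
open import Data.Nat.Properties
open import Data.Product using (Σ; ∃₂; _×_; _,_; proj₁; proj₂)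
open import Data.Product.Properties using (≡-dec)
open import Data.Sum using (_⊎_; inj₁; inj₂; [_,_])
open import Relation.Nullary using (¬_; Dec; yes; no; does)
open import Relation.Nullary.Decidable using (map′)
open import Relation.Binary.Definitions using (DecidableEquality)
open import Relation.Binary.PropositionalEquality hiding ([_])
open import Function using (_∘_)

data Letter : Set where
  A X : (inverted : Bool) → Letter

inverse : Letter → Letter
inverse (A i) = A (not i)
inverse (X i) = X (not i)

_≟ᴸ_ : DecidableEquality Letter
A i ≟ᴸ A j = map′ (cong A) (λ { refl → refl }) (i ≟ᵇ j)
A _ ≟ᴸ X _ = no λ ()
X _ ≟ᴸ A _ = no λ ()
X i ≟ᴸ X j = map′ (cong X) (λ { refl → refl }) (i ≟ᵇ j)

letters : List Letter
letters = A false ∷ A true ∷ X false ∷ X true ∷ []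

every-letter : ∀ g → g ∈ letters
every-letter (A false) = here refl
every-letter (A true)  = there (here refl)
every-letter (X false) = there (there (here refl))
every-letter (X true)  = there (there (there (here refl)))

-- A lane (h , t) stands for the power x^(2h+t) of x, i.e. for a^(n·h) x^t.
Lane : Set
Lane = Bool × Bool

twisted : Lane → Bool
twisted = proj₂

up down : Bool → Letter
up t   = A t
down t = inverse (up t)

turn : Bool → Lane → Lane
turn false (h , false) = h , true
turn false (h , true)  = not h , false
turn true  (h , false) = not h , true
turn true  (h , true)  = h , false

twisted-turn : ∀ s ℓ → twisted (turn s ℓ) ≡ not (twisted ℓ)
twisted-turn false (_ , false) = refl
twisted-turn false (_ , true)  = refl
twisted-turn true  (_ , false) = refl
twisted-turn true  (_ , true)  = refl

laneOf : Letter → Lane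
laneOf (A i) = i , false
laneOf (X i) = i , true

laneOf-injective : ∀ {g g′} → laneOf g ≡ laneOf g′ → g ≡ g′
laneOf-injective {A _} {A _} refl = refl
laneOf-injective {X _} {X _} refl = refl

Cell : Set
Cell = ℕ × Lane

_≟ᶜ_ : DecidableEquality Cell
_≟ᶜ_ = ≡-dec _≟_ (≡-dec _≟ᵇ_ _≟ᵇ_)

T-does-∨ : ∀ {P : Set} {b} (d : Dec P) → T (does d ∨ b) → P ⊎ (¬ P × T b)
T-does-∨ (yes p) _ = inj₁ p
T-does-∨ (no ¬p) t = inj₂ (¬p , t)

T-not-does-∧ : ∀ {P : Set} {b} (d : Dec P) → T (not (does d) ∧ b) → ¬ P × T b
T-not-does-∧ (no ¬p) t = ¬p , t

-- Bounded game search on a window of columns 0 … d.  The fuel bounds the moves of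
-- the searching player; `seen` lists the visited cells, the current one included.
module Board (d : ℕ) where
  open import Data.List.Membership.DecPropositional _≟ᶜ_ using (_∈?_)

  ascend descend : Cell → Maybe Cell
  ascend (k , ℓ) with k <? d
  ... | yes _ = just (suc k , ℓ)
  ... | no _  = nothing
  descend (zero  , ℓ) = nothing
  descend (suc k , ℓ) = just (k , ℓ)

  step : Cell → Letter → Maybe Cell
  step (k , ℓ) (X s) = just (k , turn s ℓ)
  step p@(_ , _ , false) (A false) = ascend p
  step p@(_ , _ , false) (A true)  = descend p
  step p@(_ , _ , true)  (A false) = descend p
  step p@(_ , _ , true)  (A true)  = ascend p

  wins advance loses answer : ℕ → Cell → List Cell → Letter → Bool
  wins zero    p seen l = false
  wins (suc f) p seen l = any (λ g → not (does (g ≟ᴸ inverse l)) ∧ advance f p seen g) letters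
  advance f p seen g with step p g
  ... | nothing = false
  ... | just p′ = does (p′ ∈? seen) ∨ loses f p′ (p′ ∷ seen) g
  loses f p seen l = all (λ g → does (g ≟ᴸ inverse l) ∨ answer f p seen g) letters
  answer f p seen g with step p g
  ... | nothing = false
  ... | just p′ = not (does (p′ ∈? seen)) ∧ wins f p′ (p′ ∷ seen) g

  rim-e : Cell
  rim-e = d , true , false

  wins-from : Cell → Lane → Letter → Bool
  wins-from p ℓ l = wins 3 p (p ∷ (0 , ℓ) ∷ rim-e ∷ []) l

module NormalForm (n : ℕ) .{{_ : NonZero n}} where
  open Dicyclic n

  N : ℕ
  N = 2 * n

  N≡n+n : N ≡ n + n
  N≡n+n = cong (n +_) (+-identityʳ n)

  n<N : n < N
  n<N = subst (n <_) (sym N≡n+n) (m<m+n n (>-nonZero⁻¹ n))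

  1<N : 1 < N
  1<N = ≤-trans (s≤s (>-nonZero⁻¹ n)) n<N

  md-cong : ∀ {k j} → k % N ≡ j % N → md k ≡ md j
  md-cong eq = toℕ-injective (trans (toℕ-fromℕ< _) (trans eq (sym (toℕ-fromℕ< _))))

  toℕ-md : ∀ {k} → k < N → toℕ (md k) ≡ k
  toℕ-md k<N = trans (toℕ-fromℕ< _) (m<n⇒m%n≡m k<N)

  md-toℕ-+ : ∀ k j → md (toℕ (md k) + j) ≡ md (k + j)
  md-toℕ-+ k j = md-cong (begin
    (toℕ (md k) + j) % N      ≡⟨ cong (λ u → (u + j) % N) (toℕ-fromℕ< _) ⟩
    (k % N + j) % N           ≡⟨ %-distribˡ-+ (k % N) j N ⟩
    (k % N % N + j % N) % N   ≡⟨ cong (λ u → (u + j % N) % N) (m%n%n≡m%n k N) ⟩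
    (k % N + j % N) % N       ≡⟨ %-distribˡ-+ k j N ⟨
    (k + j) % N               ∎)
    where open ≡-Reasoning

  md-+N : ∀ k → md (k + N) ≡ md k
  md-+N k = md-cong ([m+n]%n≡m%n k N)

  offset : Bool → ℕ
  offset false = 0
  offset true  = n

  infix 25 a^_x^_
  a^_x^_ : ℕ → Lane → Dic
  a^ c x^ (h , t) = md (c + offset h) , t

  private
    index-a : toℕ (md 1) ≡ 1
    index-a = toℕ-md 1<N

    index-a⁻¹ : toℕ (md (N ∸ toℕ (md 1))) ≡ N ∸ 1
    index-a⁻¹ = trans (cong (λ i → toℕ (md (N ∸ i))) index-a) (toℕ-md (∸-monoʳ-< {o = 0} z<s (<⇒≤ 1<N)))

    index-x : toℕ (md 0) ≡ 0
    index-x = toℕ-md (<-trans z<s 1<N)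

    index-x⁻¹ : toℕ (md (toℕ (md 0) + n)) ≡ n
    index-x⁻¹ = trans (cong (λ i → toℕ (md (i + n))) index-x) (toℕ-md n<N)

    N∸[N∸1]≡1 : N ∸ (N ∸ 1) ≡ 1
    N∸[N∸1]≡1 = m∸[m∸n]≡n (<⇒≤ 1<N)

    md-suc : ∀ k → md (toℕ (md k) + 1) ≡ md (suc k)
    md-suc k = trans (md-toℕ-+ k 1) (cong md (+-comm k 1))

    md-pred : ∀ k → md (toℕ (md (suc k)) + (N ∸ 1)) ≡ md k
    md-pred k = begin
      md (toℕ (md (suc k)) + (N ∸ 1)) ≡⟨ md-toℕ-+ (suc k) (N ∸ 1) ⟩
      md (suc k + (N ∸ 1))            ≡⟨ cong md (+-suc k (N ∸ 1)) ⟨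
      md (k + suc (N ∸ 1))            ≡⟨ cong (λ m → md (k + m)) (m+[n∸m]≡n (<⇒≤ 1<N)) ⟩
      md (k + N)                      ≡⟨ md-+N k ⟩
      md k                            ∎
      where open ≡-Reasoning

    md-half-turn : ∀ c h → md (c + offset h + n) ≡ md (c + offset (not h))
    md-half-turn c false = cong (λ m → md (m + n)) (+-identityʳ c)
    md-half-turn c true  = begin
      md (c + n + n)   ≡⟨ cong md (trans (+-assoc c n n) (cong (c +_) (sym N≡n+n))) ⟩
      md (c + N)       ≡⟨ md-+N c ⟩
      md c             ≡⟨ cong md (+-identityʳ c) ⟨
      md (c + 0)       ∎
      where open ≡-Reasoning

  el : Letter → Dic
  el (A false) = a
  el (A true)  = a ⁻¹
  el (X false) = x
  el (X true)  = x ⁻¹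

  up-law : ∀ c ℓ → a^ c x^ ℓ ∙ el (up (twisted ℓ)) ≡ a^ suc c x^ ℓ
  up-law c (h , false) = cong (_, false) (begin
    md (toℕ (md k) + toℕ (md 1))                      ≡⟨ cong (λ i → md (toℕ (md k) + i)) index-a ⟩
    md (toℕ (md k) + 1)                               ≡⟨ md-suc k ⟩
    md (suc k)                                        ∎)
    where k = c + offset h
          open ≡-Reasoning
  up-law c (h , true) = cong (_, true) (begin
    md (toℕ (md k) + (N ∸ toℕ (md (N ∸ toℕ (md 1))))) ≡⟨ cong (λ i → md (toℕ (md k) + (N ∸ i))) index-a⁻¹ ⟩
    md (toℕ (md k) + (N ∸ (N ∸ 1)))                   ≡⟨ cong (λ i → md (toℕ (md k) + i)) N∸[N∸1]≡1 ⟩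
    md (toℕ (md k) + 1)                               ≡⟨ md-suc k ⟩
    md (suc k)                                        ∎)
    where k = c + offset h
          open ≡-Reasoning

  down-law : ∀ c ℓ → a^ suc c x^ ℓ ∙ el (down (twisted ℓ)) ≡ a^ c x^ ℓ
  down-law c (h , false) = cong (_, false) (begin
    md (toℕ (md (suc k)) + toℕ (md (N ∸ toℕ (md 1)))) ≡⟨ cong (λ i → md (toℕ (md (suc k)) + i)) index-a⁻¹ ⟩
    md (toℕ (md (suc k)) + (N ∸ 1))                   ≡⟨ md-pred k ⟩
    md k                                              ∎)
    where k = c + offset h
          open ≡-Reasoning
  down-law c (h , true) = cong (_, true) (begin
    md (toℕ (md (suc k)) + (N ∸ toℕ (md 1)))          ≡⟨ cong (λ i → md (toℕ (md (suc k)) + (N ∸ i))) index-a ⟩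
    md (toℕ (md (suc k)) + (N ∸ 1))                   ≡⟨ md-pred k ⟩
    md k                                              ∎)
    where k = c + offset h
          open ≡-Reasoning

  turn-law : ∀ c s ℓ → a^ c x^ ℓ ∙ el (X s) ≡ a^ c x^ turn s ℓ
  turn-law c false (h , false) = cong (_, true) (begin
    md (toℕ (md k) + toℕ (md 0))                      ≡⟨ cong (λ i → md (toℕ (md k) + i)) index-x ⟩
    md (toℕ (md k) + 0)                               ≡⟨ md-toℕ-+ k 0 ⟩
    md (k + 0)                                        ≡⟨ cong md (+-identityʳ k) ⟩
    md k                                              ∎)
    where k = c + offset h
          open ≡-Reasoning
  turn-law c false (h , true) = cong (_, false) (begin
    md (toℕ (md k) + (N ∸ toℕ (md 0)) + n)            ≡⟨ cong (λ i → md (toℕ (md k) + (N ∸ i) + n)) index-x ⟩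
    md (toℕ (md k) + N + n)                           ≡⟨ cong md (+-assoc (toℕ (md k)) N n) ⟩
    md (toℕ (md k) + (N + n))                         ≡⟨ md-toℕ-+ k (N + n) ⟩
    md (k + (N + n))                                  ≡⟨ cong md (trans (cong (k +_) (+-comm N n)) (sym (+-assoc k n N))) ⟩
    md (k + n + N)                                    ≡⟨ md-+N (k + n) ⟩
    md (k + n)                                        ≡⟨ md-half-turn c h ⟩
    md (c + offset (not h))                           ∎)
    where k = c + offset h
          open ≡-Reasoning
  turn-law c true (h , false) = cong (_, true) (begin
    md (toℕ (md k) + toℕ (md (toℕ (md 0) + n)))       ≡⟨ cong (λ i → md (toℕ (md k) + i)) index-x⁻¹ ⟩
    md (toℕ (md k) + n)                               ≡⟨ md-toℕ-+ k n ⟩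
    md (k + n)                                        ≡⟨ md-half-turn c h ⟩
    md (c + offset (not h))                           ∎)
    where k = c + offset h
          open ≡-Reasoning
  turn-law c true (h , true) = cong (_, false) (begin
    md (toℕ (md k) + (N ∸ toℕ (md (toℕ (md 0) + n))) + n)
                                                      ≡⟨ cong (λ i → md (toℕ (md k) + (N ∸ i) + n)) index-x⁻¹ ⟩
    md (toℕ (md k) + (N ∸ n) + n)                     ≡⟨ cong md (+-assoc (toℕ (md k)) (N ∸ n) n) ⟩
    md (toℕ (md k) + (N ∸ n + n))                     ≡⟨ cong (λ i → md (toℕ (md k) + i)) (m∸n+n≡m (<⇒≤ n<N)) ⟩
    md (toℕ (md k) + N)                               ≡⟨ md-toℕ-+ k N ⟩
    md (k + N)                                        ≡⟨ md-+N k ⟩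
    md k                                              ∎)
    where k = c + offset h
          open ≡-Reasoning

  wrap-law : ∀ h t → a^ n x^ (h , t) ≡ a^ 0 x^ (not h , t)
  wrap-law false t = cong (λ m → md m , t) (+-identityʳ n)
  wrap-law true  t = cong (_, t) (trans (cong md (sym N≡n+n)) (md-+N 0))

  private
    offset-< : ∀ {c} h → c < n → c + offset h < N
    offset-< {c} false c<n = subst (_< N) (sym (+-identityʳ c)) (<-trans c<n n<N)
    offset-< {c} true  c<n = subst (c + n <_) (sym N≡n+n) (+-monoˡ-< n c<n)

    offset-injective : ∀ {c c′} h h′ → c < n → c′ < n →
                       c + offset h ≡ c′ + offset h′ → c ≡ c′ × h ≡ h′
    offset-injective {c} {c′} false false _ _ eq =
      trans (sym (+-identityʳ c)) (trans eq (+-identityʳ c′)) , refl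
    offset-injective {c} {c′} true true _ _ eq = +-cancelʳ-≡ n c c′ eq , refl
    offset-injective {c} {c′} false true c<n _ eq =
      ⊥-elim (<⇒≱ c<n (≤-trans (m≤n+m n c′) (≤-reflexive (sym (trans (sym (+-identityʳ c)) eq)))))
    offset-injective {c} {c′} true false _ c′<n eq =
      ⊥-elim (<⇒≱ c′<n (≤-trans (m≤n+m n c) (≤-reflexive (trans eq (+-identityʳ c′)))))

  a^x^-injective : ∀ {c c′ ℓ ℓ′} → c < n → c′ < n → a^ c x^ ℓ ≡ a^ c′ x^ ℓ′ → c ≡ c′ × ℓ ≡ ℓ′
  a^x^-injective {c} {c′} {h , t} {h′ , t′} c<n c′<n eq
    with offset-injective h h′ c<n c′<n
           (trans (sym (toℕ-md (offset-< h c<n)))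
                  (trans (cong (toℕ ∘ proj₁) eq) (toℕ-md (offset-< h′ c′<n))))
  ... | c≡c′ , refl = c≡c′ , cong (h ,_) (cong proj₂ eq)

  column : Letter → ℕ
  column (A false) = 1
  column (A true)  = n ∸ 1
  column (X _)     = 0

  el-cell : ∀ g → el g ≡ a^ column g x^ laneOf g
  el-cell (A false) = refl
  el-cell (A true)  = cong (λ i → md i , false) (begin
    N ∸ toℕ (md 1)  ≡⟨ cong (N ∸_) index-a ⟩
    N ∸ 1           ≡⟨ cong (_∸ 1) N≡n+n ⟩
    n + n ∸ 1       ≡⟨ +-∸-comm n (>-nonZero⁻¹ n) ⟩
    (n ∸ 1) + n     ∎)
    where open ≡-Reasoning
  el-cell (X false) = refl
  el-cell (X true)  = cong (λ i → md (i + n) , true) index-x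

  el-inverse : ∀ g → el (inverse g) ≡ el g ⁻¹
  el-inverse (A false) = refl
  el-inverse (A true)  = cong (_, false) (sym (begin
    md (N ∸ toℕ (md (N ∸ toℕ (md 1)))) ≡⟨ cong (λ i → md (N ∸ i)) index-a⁻¹ ⟩
    md (N ∸ (N ∸ 1))                   ≡⟨ cong md N∸[N∸1]≡1 ⟩
    md 1                               ∎))
    where open ≡-Reasoning
  el-inverse (X false) = refl
  el-inverse (X true)  = cong (_, true) (sym (begin
    md (toℕ (md (toℕ (md 0) + n)) + n) ≡⟨ cong (λ i → md (i + n)) index-x⁻¹ ⟩
    md (n + n)                         ≡⟨ cong md N≡n+n ⟨
    md (0 + N)                         ≡⟨ md-+N 0 ⟩
    md 0                               ∎))
    where open ≡-Reasoning

  el-injective : 1 < n → ∀ {g g′} → el g ≡ el g′ → g ≡ g′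
  el-injective 1<n {g} {g′} eq = laneOf-injective (proj₂ (a^x^-injective (column-< g) (column-< g′)
    (trans (sym (el-cell g)) (trans eq (el-cell g′)))))
    where
      column-< : ∀ g → column g < n
      column-< (A false) = 1<n
      column-< (A true)  = ∸-monoʳ-< {o = 0} z<s (>-nonZero⁻¹ n)
      column-< (X _)     = >-nonZero⁻¹ n

odd : ℕ → Bool
odd zero    = false
odd (suc r) = not (odd r)

odd-double : ∀ k → odd (2 * k) ≡ false
odd-double zero    = refl
odd-double (suc k) = begin
  odd (2 * suc k)        ≡⟨ cong odd (*-suc 2 k) ⟩
  not (not (odd (2 * k))) ≡⟨ not-involutive (odd (2 * k)) ⟩
  odd (2 * k)            ≡⟨ odd-double k ⟩
  false                  ∎
  where open ≡-Reasoning

module Strategy (n : ℕ) .{{_ : NonZero n}} (1<n : 1 < n) where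
  open Dicyclic n
  open NormalForm n

  move : ∀ g → Move (el g)
  move (A false) = inj₁ (here refl)
  move (X false) = inj₁ (there (here refl))
  move (A true)  = inj₂ (here refl)
  move (X true)  = inj₂ (there (here refl))

  legal : ∀ {g l} → g ≢ inverse l → Legal (just (el l)) (el g)
  legal {g} {l} g≢ = move g , λ eq → g≢ (el-injective 1<n (trans eq (sym (el-inverse l))))

  Reply : Dic → List Dic → Letter → Set
  Reply w past g = w ∙ el g ∉ w ∷ past × Win (w ∙ el g) (w ∷ past) (just (el g))

  reply : ∀ {w past g w′} → w ∙ el g ≡ w′ → w′ ∉ w ∷ past → Win w′ (w ∷ past) (just (el g)) →
          Reply w past g
  reply refl fresh win = fresh , win

  win-immediately : ∀ {w past l} g → g ≢ inverse l → w ∙ el g ∈ w ∷ past → Win w past (just (el l))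
  win-immediately g g≢ repeated = win-now (el g) (legal g≢) repeated

  win-by : ∀ {w past l w′} g → g ≢ inverse l → w ∙ el g ≡ w′ → w′ ∉ w ∷ past →
           Lose w′ (w ∷ past) (just (el g)) → Win w past (just (el l))
  win-by g g≢ refl fresh lost = win-move (el g) (legal g≢) fresh lost

  unreversed : ∀ {g l} → el g ≢ el l ⁻¹ → g ≢ inverse l
  unreversed {l = l} ok eq = ok (trans (cong el eq) (el-inverse l))

  lose-to-every-reply : ∀ {w past l} → (∀ g → g ≢ inverse l → Reply w past g) →
                        Lose w past (just (el l))
  lose-to-every-reply {l = l} replies = lose λ where
    _ (inj₁ (here refl) , ok)         → replies (A false) (unreversed ok)
    _ (inj₁ (there (here refl)) , ok) → replies (X false) (unreversed ok)
    _ (inj₂ (here refl) , ok)         → replies (A true) (unreversed ok)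
    _ (inj₂ (there (here refl)) , ok) → replies (X true) (unreversed ok)
    _ (inj₁ (there (there ())) , _)
    _ (inj₂ (there (there ())) , _)

  Behind : ℕ → Dic → Set
  Behind k y = y ≡ e ⊎ ∃₂ λ c ℓ → 0 < c × c < k × y ≡ a^ c x^ ℓ

  ahead-∉ : ∀ {k c ℓ past} → All (Behind k) past → 0 < c → k ≤ c → c < n → a^ c x^ ℓ ∉ past
  ahead-∉ behind 0<c k≤c c<n mem with All.lookup behind mem
  ... | inj₁ eq = <⇒≢ 0<c (sym (proj₁ (a^x^-injective c<n (>-nonZero⁻¹ n) eq)))
  ... | inj₂ (_ , _ , _ , c′<k , eq) =
    <⇒≢ (<-≤-trans c′<k k≤c) (sym (proj₁ (a^x^-injective c<n (<-≤-trans c′<k (≤-trans k≤c (<⇒≤ c<n))) eq)))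

  module Endgame (b d : ℕ) (0<b : 0 < b) (d+b≡n : d + b ≡ n) where
    open Board d
    open import Data.List.Membership.DecPropositional _≟ᶜ_ using (_∈?_)

    ⟦_⟧ : Cell → Dic
    ⟦ k , ℓ ⟧ = a^ k + b x^ ℓ

    Region : Cell → Set
    Region (k , _) = k ≤ d

    rim-wraps : ∀ h t → ⟦ d , h , t ⟧ ≡ a^ 0 x^ (not h , t)
    rim-wraps h t = trans (cong (λ c → a^ c x^ (h , t)) d+b≡n) (wrap-law h t)

    private
      inner-< : ∀ {k} → k < d → k + b < n
      inner-< k<d = subst (_ <_) d+b≡n (+-monoˡ-< _ k<d)

      k+b≢0 : ∀ k → k + b ≢ 0
      k+b≢0 k eq = <⇒≢ (<-≤-trans 0<b (m≤n+m b k)) (sym eq)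

    ⟦⟧-injective : ∀ {p q} → Region p → Region q → ⟦ p ⟧ ≡ ⟦ q ⟧ → p ≡ q
    ⟦⟧-injective {k , h , t} {k′ , h′ , t′} k≤d k′≤d eq
      with m≤n⇒m<n∨m≡n k≤d | m≤n⇒m<n∨m≡n k′≤d
    ... | inj₁ k<d | inj₁ k′<d with a^x^-injective (inner-< k<d) (inner-< k′<d) eq
    ...   | k+b≡k′+b , refl = cong (_, h , t) (+-cancelʳ-≡ b k k′ k+b≡k′+b)
    ⟦⟧-injective {k , h , t} {_ , h′ , t′} _ _ eq | inj₁ k<d | inj₂ refl =
      ⊥-elim (k+b≢0 k (proj₁ (a^x^-injective (inner-< k<d) (>-nonZero⁻¹ n) (trans eq (rim-wraps h′ t′)))))
    ⟦⟧-injective {_ , h , t} {k′ , h′ , t′} _ _ eq | inj₂ refl | inj₁ k′<d =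
      ⊥-elim (k+b≢0 k′ (proj₁ (a^x^-injective (inner-< k′<d) (>-nonZero⁻¹ n) (trans (sym eq) (rim-wraps h t)))))
    ⟦⟧-injective {_ , h , t} {_ , h′ , t′} _ _ eq | inj₂ refl | inj₂ refl
      with a^x^-injective (>-nonZero⁻¹ n) (>-nonZero⁻¹ n)
             (trans (sym (rim-wraps h t)) (trans eq (rim-wraps h′ t′)))
    ... | _ , lanes≡ = cong₂ (λ h t → d , h , t) (not-injective (cong proj₁ lanes≡)) (cong proj₂ lanes≡)

    behind-region-is-e : ∀ {p} → Region p → Behind b ⟦ p ⟧ → ⟦ p ⟧ ≡ e
    behind-region-is-e _ (inj₁ eq) = eq
    behind-region-is-e {k , ℓ} k≤d (inj₂ (c , _ , 0<c , c<b , eq))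
      with m≤n⇒m<n∨m≡n k≤d | <-≤-trans c<b (≤-trans (m≤n+m b d) (≤-reflexive d+b≡n))
    ... | inj₁ k<d | c<n =
      ⊥-elim (<⇒≱ c<b (≤-trans (m≤n+m b k) (≤-reflexive (proj₁ (a^x^-injective (inner-< k<d) c<n eq)))))
    ... | inj₂ refl | c<n =
      ⊥-elim (<⇒≢ 0<c (proj₁ (a^x^-injective (>-nonZero⁻¹ n) c<n (trans (sym (rim-wraps _ _)) eq))))

    record Tracks (h : List Cell) (past : List Dic) : Set where
      field
        sound    : ∀ {p} → p ∈ h → ⟦ p ⟧ ∈ past
        complete : ∀ {p} → Region p → ⟦ p ⟧ ∈ past → p ∈ h
    open Tracks

    tracks-∷ : ∀ {p h past} → Region p → Tracks h past → Tracks (p ∷ h) (⟦ p ⟧ ∷ past)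
    tracks-∷ rp tr .sound (here refl) = here refl
    tracks-∷ rp tr .sound (there q∈h) = there (tr .sound q∈h)
    tracks-∷ rp tr .complete rq (here eq) = here (⟦⟧-injective rq rp eq)
    tracks-∷ rp tr .complete rq (there mem) = there (tr .complete rq mem)

    tracks-behind : ∀ {past} → All (Behind b) past → e ∈ past → Tracks (rim-e ∷ []) past
    tracks-behind {past} _ e∈ .sound (here refl) = subst (_∈ past) (sym (rim-wraps true false)) e∈
    tracks-behind behind _ .complete rq mem =
      here (⟦⟧-injective rq ≤-refl
              (trans (behind-region-is-e rq (All.lookup behind mem)) (sym (rim-wraps true false))))

    step-sound : ∀ {p g p′} → Region p → step p g ≡ just p′ → ⟦ p ⟧ ∙ el g ≡ ⟦ p′ ⟧ × Region p′
    step-sound {k , ℓ} {X s} k≤d refl = turn-law (k + b) s ℓ , k≤d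
    step-sound {k , h , false} {A false} _ eq with k <? d
    step-sound {k , h , false} {A false} _ refl | yes k<d = up-law (k + b) (h , false) , k<d
    step-sound {suc k , h , false} {A true} k<d refl = down-law (k + b) (h , false) , <⇒≤ k<d
    step-sound {suc k , h , true} {A false} k<d refl = down-law (k + b) (h , true) , <⇒≤ k<d
    step-sound {k , h , true} {A true} _ eq with k <? d
    step-sound {k , h , true} {A true} _ refl | yes k<d = up-law (k + b) (h , true) , k<d

    wins-sound : ∀ f {p seen l past} → Region p → Tracks seen (⟦ p ⟧ ∷ past) →
                 T (wins f p seen l) → Win ⟦ p ⟧ past (just (el l))
    advance-sound : ∀ f {p seen g l past} → g ≢ inverse l → Region p → Tracks seen (⟦ p ⟧ ∷ past) →
                    T (advance f p seen g) → Win ⟦ p ⟧ past (just (el l))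
    loses-sound : ∀ f {p seen l past} → Region p → Tracks seen (⟦ p ⟧ ∷ past) →
                  T (loses f p seen l) → Lose ⟦ p ⟧ past (just (el l))
    answer-sound : ∀ f {p seen g past} → Region p → Tracks seen (⟦ p ⟧ ∷ past) →
                   T (answer f p seen g) → Reply ⟦ p ⟧ past g

    wins-sound (suc f) {p} {seen} {l} rp tr won
      with satisfied (any⁻ (λ g → not (does (g ≟ᴸ inverse l)) ∧ advance f p seen g) letters won)
    ... | g , legal-advance with T-not-does-∧ (g ≟ᴸ inverse l) legal-advance
    ...   | g≢ , adv = advance-sound f {g = g} {l = l} g≢ rp tr adv

    advance-sound f {p} {seen} {g} g≢ rp tr adv with step p g in eq
    ... | just p′ with step-sound {p} {g} rp eq | T-does-∨ (p′ ∈? seen) adv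
    ...   | moved , rp′ | inj₁ p′∈ = win-immediately g g≢ (subst (_∈ _) (sym moved) (tr .sound p′∈))
    ...   | moved , rp′ | inj₂ (p′∉ , lost) =
      win-by g g≢ moved (p′∉ ∘ tr .complete rp′) (loses-sound f {l = g} rp′ (tracks-∷ rp′ tr) lost)

    loses-sound f {p} {seen} {l} rp tr lost = lose-to-every-reply λ g g≢ →
      answered g g≢ (All.lookup (all⁺ (λ g → does (g ≟ᴸ inverse l) ∨ answer f p seen g) letters lost)
                                (every-letter g))
      where
        answered : ∀ g → g ≢ inverse l → T (does (g ≟ᴸ inverse l) ∨ answer f p seen g) → Reply ⟦ p ⟧ _ g
        answered g g≢ ans with T-does-∨ (g ≟ᴸ inverse l) ans
        ... | inj₁ g≡ = ⊥-elim (g≢ g≡)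
        ... | inj₂ (_ , ans′) = answer-sound f {g = g} rp tr ans′

    answer-sound f {p} {seen} {g} rp tr ans with step p g in eq
    ... | just p′ with step-sound {p} {g} rp eq | T-not-does-∧ (p′ ∈? seen) ans
    ...   | moved , rp′ | p′∉ , won =
      reply {g = g} moved (p′∉ ∘ tr .complete rp′) (wins-sound f rp′ (tracks-∷ rp′ tr) won)

    endgame : ∀ {ℓ past} p l → Region p → All (Behind b) past → e ∈ past →
              T (wins-from p ℓ l) → Win ⟦ p ⟧ (a^ b x^ ℓ ∷ past) (just (el l))
    endgame p l rp behind e∈ =
      wins-sound 3 {l = l} rp (tracks-∷ rp (tracks-∷ z≤n (tracks-behind behind e∈)))

  Behind-mono : ∀ {k k′ y} → k ≤ k′ → Behind k y → Behind k′ y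
  Behind-mono _ (inj₁ eq) = inj₁ eq
  Behind-mono k≤k′ (inj₂ (c , ℓ , 0<c , c<k , eq)) = inj₂ (c , ℓ , 0<c , <-≤-trans c<k k≤k′ , eq)

  behind-∷ : ∀ {c ℓ past} → All (Behind (suc c)) past → All (Behind (2 + c)) (a^ suc c x^ ℓ ∷ past)
  behind-∷ behind = inj₂ (_ , _ , z<s , ≤-refl , refl) ∷ All.map (Behind-mono (n≤1+n _)) behind

  finish-straight : ∀ {c ℓ past} → 3 + c ≡ n → twisted ℓ ≡ false → All (Behind (suc c)) past → e ∈ past →
                    Win (a^ 2 + c x^ ℓ) (a^ suc c x^ ℓ ∷ past) (just (el (up (twisted ℓ))))
  finish-straight {c} {h , false} eq refl behind e∈ =
    Endgame.endgame (suc c) 2 z<s eq (1 , h , false) (A false) (s≤s z≤n) behind e∈ (verified h)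
    where
      verified : ∀ h → T (Board.wins-from 2 (1 , h , false) (h , false) (A false))
      verified false = _
      verified true  = _

  finish-twisted : ∀ {c ℓ past} → 4 + c ≡ n → twisted ℓ ≡ true → All (Behind (suc c)) past → e ∈ past →
                   Win (a^ 2 + c x^ ℓ) (a^ suc c x^ ℓ ∷ past) (just (el (up (twisted ℓ))))
  finish-twisted {c} {h , true} eq refl behind e∈ =
    Endgame.endgame (suc c) 3 z<s eq (1 , h , true) (A true) (s≤s z≤n) behind e∈ (verified h)
    where
      verified : ∀ h → T (Board.wins-from 3 (1 , h , true) (h , true) (A true))
      verified false = _
      verified true  = _

  finish-turned : ∀ {c ℓ past} s → 3 + c ≡ n → twisted ℓ ≡ false → All (Behind (suc c)) past → e ∈ past →
                  Win (a^ suc c x^ turn s ℓ) (a^ suc c x^ ℓ ∷ past) (just (el (X s)))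
  finish-turned {c} {h , false} s eq refl behind e∈ =
    Endgame.endgame (suc c) 2 z<s eq (0 , turn s (h , false)) (X s) z≤n behind e∈ (verified s h)
    where
      verified : ∀ s h → T (Board.wins-from 2 (0 , turn s (h , false)) (h , false) (X s))
      verified false false = _
      verified false true  = _
      verified true  false = _
      verified true  true  = _

  private
    A-injective : ∀ {i j} → A i ≡ A j → i ≡ j
    A-injective refl = refl

    up≢down : ∀ t → up t ≢ inverse (up t)
    up≢down t = not-¬ refl ∘ A-injective

    frontier-< : ∀ {r c} → r + (3 + c) ≡ n → 2 + c < n
    frontier-< {r} {c} eq = ≤-trans (m≤n+m (3 + c) r) (≤-reflexive eq)

  open import Data.List.Membership.DecPropositional {A = Dic} (≡-dec Fin._≟_ _≟ᵇ_) using (_∈?_)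

  advancing : ∀ r c ℓ {past} → r + (3 + c) ≡ n → twisted ℓ ≡ odd r → All (Behind (suc c)) past → e ∈ past →
              Lose (a^ suc c x^ ℓ) past (just (el (up (twisted ℓ))))
  reply-to-advance : ∀ r c ℓ {past} → r + (3 + c) ≡ n → twisted ℓ ≡ odd r → All (Behind (suc c)) past →
                     e ∈ past → Win (a^ 2 + c x^ ℓ) (a^ suc c x^ ℓ ∷ past) (just (el (up (twisted ℓ))))
  reply-to-turn : ∀ r c ℓ s {past} → r + (3 + c) ≡ n → twisted ℓ ≡ odd r → All (Behind (suc c)) past →
                  e ∈ past → Win (a^ suc c x^ turn s ℓ) (a^ suc c x^ ℓ ∷ past) (just (el (X s)))

  advancing r c ℓ {past} eq parity behind e∈ = lose-to-every-reply replies
    where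
      1+c<n : 1 + c < n
      1+c<n = <-trans (n<1+n _) (frontier-< eq)

      turned-away : ∀ s → a^ suc c x^ turn s ℓ ∉ a^ suc c x^ ℓ ∷ past
      turned-away s = [ (λ same → not-¬ refl (trans (sym (cong twisted (proj₂ (a^x^-injective 1+c<n 1+c<n same))))
                                                    (twisted-turn s ℓ)))
                      , ahead-∉ behind z<s ≤-refl 1+c<n
                      ] ∘ toSum

      replies : ∀ g → g ≢ inverse (up (twisted ℓ)) → Reply (a^ suc c x^ ℓ) past g
      replies (A i) g≢ with i ≟ᵇ twisted ℓ
      ... | yes refl = reply {g = up i} (up-law (suc c) ℓ)
                         (ahead-∉ (behind-∷ behind) z<s ≤-refl (frontier-< eq))
                         (reply-to-advance r c ℓ eq parity behind e∈)
      ... | no i≢t   = ⊥-elim (g≢ (cong A (¬-not i≢t)))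
      replies (X s) _ = reply {g = X s} (turn-law (suc c) s ℓ) (turned-away s)
                          (reply-to-turn r c ℓ s eq parity behind e∈)

  reply-to-advance zero          c ℓ eq parity behind e∈ = finish-straight eq parity behind e∈
  reply-to-advance (suc zero)    c ℓ eq parity behind e∈ = finish-twisted eq parity behind e∈
  reply-to-advance (suc (suc r)) c ℓ eq parity behind e∈ =
    win-by (up (twisted ℓ)) (up≢down _) (up-law (2 + c) ℓ)
      (ahead-∉ behind″ z<s ≤-refl (<-trans (n<1+n _) (frontier-< eq′)))
      (advancing r (2 + c) ℓ eq′ (trans parity (not-involutive (odd r))) behind″ (there (there e∈)))
    where
      eq′ : r + (3 + (2 + c)) ≡ n
      eq′ = trans (+-suc r (4 + c)) (trans (cong suc (+-suc r (3 + c))) eq)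
      behind″ : All (Behind (3 + c)) (a^ 2 + c x^ ℓ ∷ a^ suc c x^ ℓ ∷ _)
      behind″ = behind-∷ (behind-∷ behind)

  reply-to-turn r c ℓ s {past} eq parity behind e∈
    with a^ c x^ turn s ℓ ∈? (a^ suc c x^ turn s ℓ ∷ a^ suc c x^ ℓ ∷ past)
  ... | yes visited =
    win-immediately {l = X s} (down (twisted (turn s ℓ))) (λ ())
      (subst (_∈ a^ suc c x^ turn s ℓ ∷ a^ suc c x^ ℓ ∷ past) (sym (down-law c (turn s ℓ))) visited)
  reply-to-turn zero    c ℓ s eq parity behind e∈ | no _ = finish-turned s eq parity behind e∈
  reply-to-turn (suc r) c ℓ s eq parity behind e∈ | no _ =
    win-by {l = X s} (up (twisted (turn s ℓ))) (λ ()) (up-law (suc c) (turn s ℓ))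
      (ahead-∉ behind′ z<s ≤-refl (frontier-< {suc r} eq))
      (advancing r (suc c) (turn s ℓ) (trans (+-suc r (3 + c)) eq)
        (trans (twisted-turn s ℓ) (trans (cong not parity) (not-involutive (odd r))))
        behind′ (there (there e∈)))
    where
      behind′ : All (Behind (2 + c)) (a^ suc c x^ turn s ℓ ∷ a^ suc c x^ ℓ ∷ _)
      behind′ = inj₂ (_ , _ , z<s , ≤-refl , refl) ∷ behind-∷ behind

  opening : ∀ r → r + 3 ≡ n → odd r ≡ false → Player1Wins
  opening r r+3≡n parity =
    win-move a (move (A false)) (subst (_∉ e ∷ []) (sym (up-law 0 (false , false))) fresh)
      (subst (λ w → Lose w (e ∷ []) (just a)) (sym (up-law 0 (false , false)))
        (advancing r 0 (false , false) r+3≡n (sym parity) (inj₁ refl ∷ []) (here refl)))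
    where
      fresh : a^ 1 x^ (false , false) ∉ e ∷ []
      fresh = ahead-∉ (inj₁ refl ∷ []) z<s ≤-refl 1<n

theorem4p3 : (n : ℕ) .{{_ : NonZero n}} → 3 ≤ n → Σ ℕ (λ k → n ≡ suc (2 * k)) →
    Dicyclic.Player1Wins n
theorem4p3 n 3≤n (zero , refl) = ⊥-elim (<⇒≱ 3≤n (s≤s z≤n))
theorem4p3 n 3≤n (suc k , n≡) =
  Strategy.opening n (≤-trans (s≤s (s≤s z≤n)) 3≤n) (2 * k)
    (trans (+-comm (2 * k) 3) (sym (trans n≡ (cong suc (*-suc 2 k))))) (odd-double k)
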